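{- Let $(P,\leq,1)$ be a finite poset with top element $1$ having pseudocomplemented sections, and let $a,b\in P$. Then: (i) if the join $a\vee b$ exists in $(P,\leq)$, then $a\rightarrow b=\{(a\vee b)^b\}$; (ii) if $b\leq a$, then $a\rightarrow b=\{a^b\}$.
   Context: For $A\subseteq P$ let $L(A)=\{x\in P\mid x\leq a\text{ for all }a\in A\}$ and $U(A)=\{x\in P\mid a\leq x\text{ for all }a\in A\}$; $L(a,b)$ means $L(\{a,b\})$, etc. $\operatorname{Min}A$ and $\operatorname{Max}A$ denote the sets of minimal and maximal elements of $A$. For $y\in P$ the section is $[y,1]=\{x\in P\mid y\leq x\leq 1\}$. A finite poset $(P,\leq,1)$ with top element $1$ has pseudocomplemented sections if for every $y\in P$ and every $x\in[y,1]$ there is a greatest element $x^y$ of $[y,1]$ such that $L(x,x^y)\cap[y,1]=\{y\}$ ($x^y$ is the pseudocomplement of $x$ in the section $[y,1]$). For $x,y\in P$ the (set-valued) implication is $x\rightarrow y:=\{z^y\mid z\in\operatorname{Min}U(x,y)\}$, a nonempty subset of $P$. -}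

module Defs where

open import Level using (0ℓ)
open import Data.Nat using (ℕ)
open import Data.Fin using (Fin)
open import Data.Product using (Σ; ∃; _×_)
open import Data.Sum using (_⊎_)
open import Function.Bundles using (_↔_)
open import Relation.Binary.PropositionalEquality using (_≡_)
open import Relation.Binary.Structures using (IsPartialOrder)
open import Relation.Unary using (Pred; _∈_; _∩_; _≐_; ｛_｝)

record FinTopPoset : Set₁ where
  field
    Carrier        : Set
    _≤_            : Carrier → Carrier → Set
    isPartialOrder : IsPartialOrder _≡_ _≤_
    size           : ℕ
    finite         : Carrier ↔ Fin size
    top            : Carrier
    top-greatest   : ∀ x → x ≤ top

module Ops (𝒫 : FinTopPoset) where
  open FinTopPoset 𝒫

  ❴_,_❵ : Carrier → Carrier → Pred Carrier 0ℓ
  ❴ a , b ❵ = λ x → x ≡ a ⊎ x ≡ b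

  L : Pred Carrier 0ℓ → Pred Carrier 0ℓ
  L A = λ x → ∀ a → a ∈ A → x ≤ a

  U : Pred Carrier 0ℓ → Pred Carrier 0ℓ
  U A = λ x → ∀ a → a ∈ A → a ≤ x

  Min : Pred Carrier 0ℓ → Pred Carrier 0ℓ
  Min A = λ x → x ∈ A × (∀ y → y ∈ A → y ≤ x → y ≡ x)

  Sec : Carrier → Pred Carrier 0ℓ
  Sec y = λ x → y ≤ x × x ≤ top

  IsPC : Carrier → Carrier → Carrier → Set
  IsPC y x p =
    p ∈ Sec y
    × (L ❴ x , p ❵ ∩ Sec y) ≐ ｛ y ｝
    × (∀ q → q ∈ Sec y → (L ❴ x , q ❵ ∩ Sec y) ≐ ｛ y ｝ → q ≤ p)

  HasPCSections : Set
  HasPCSections = ∀ y x → x ∈ Sec y → Σ Carrier (IsPC y x)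

  IsJoin : Carrier → Carrier → Carrier → Set
  IsJoin a b j = j ∈ U ❴ a , b ❵ × (∀ u → u ∈ U ❴ a , b ❵ → j ≤ u)

  _⇒_ : Carrier → Carrier → Pred Carrier 0ℓ
  x ⇒ y = λ w → ∃ λ z → z ∈ Min (U ❴ x , y ❵) × IsPC y z w

{-# OPTIONS --safe #-}
module Submission where

open import Defs
open import Data.Product using (_×_; _,_)
open import Data.Sum using (inj₁; inj₂)
open import Relation.Unary using (_≐_; ｛_｝)
open import Relation.Binary.PropositionalEquality using (_≡_; refl)
open import Relation.Binary.Structures using (IsPartialOrder)
open FinTopPoset
open Ops

-- A join of a and b is the least, hence the only minimal, upper bound of {a, b};
-- so a → b has the single member j^b, pseudocomplements being unique.
-- For b ≤ a the join is a itself.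

module _ (𝒫 : FinTopPoset) where
  open IsPartialOrder (isPartialOrder 𝒫) using (antisym) renaming (refl to ≤-refl)

  IsPC-unique : ∀ {y x p q} → IsPC 𝒫 y x p → IsPC 𝒫 y x q → p ≡ q
  IsPC-unique (p∈ , p-pc , p-greatest) (q∈ , q-pc , q-greatest) =
    antisym (q-greatest _ p∈ p-pc) (p-greatest _ q∈ q-pc)

  IsJoin⇒Min-U : ∀ {a b j} → IsJoin 𝒫 a b j → Min 𝒫 (U 𝒫 (❴_,_❵ 𝒫 a b)) j
  IsJoin⇒Min-U (j∈U , j-least) = j∈U , λ y y∈U y≤j → antisym y≤j (j-least y y∈U)

  join≡Min-U : ∀ {a b j z} → IsJoin 𝒫 a b j → Min 𝒫 (U 𝒫 (❴_,_❵ 𝒫 a b)) z → j ≡ z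
  join≡Min-U {j = j} {z} (j∈U , j-least) (z∈U , z-minimal) = z-minimal j j∈U (j-least z z∈U)

  ≤⇒IsJoin : ∀ {a b} → _≤_ 𝒫 b a → IsJoin 𝒫 a b a
  ≤⇒IsJoin {a} {b} b≤a = a∈U , λ u u∈U → u∈U a (inj₁ refl)
    where
    a∈U : U 𝒫 (❴_,_❵ 𝒫 a b) a
    a∈U _ (inj₁ refl) = ≤-refl
    a∈U _ (inj₂ refl) = b≤a

  ⇒-join : ∀ {a b j c} → IsJoin 𝒫 a b j → IsPC 𝒫 b j c → _⇒_ 𝒫 a b ≐ ｛ c ｝
  ⇒-join {a} {b} {j} {c} j-join c-pc = ⇒⊆c , c⊆⇒
    where
    ⇒⊆c : ∀ {w} → _⇒_ 𝒫 a b w → c ≡ w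
    ⇒⊆c (z , z-min , w-pc) with join≡Min-U j-join z-min
    ... | refl = IsPC-unique c-pc w-pc

    c⊆⇒ : ∀ {w} → c ≡ w → _⇒_ 𝒫 a b w
    c⊆⇒ refl = j , IsJoin⇒Min-U j-join , c-pc

-- The pseudocomplements are supplied as hypotheses.
lemma1 : (𝒫 : FinTopPoset) → HasPCSections 𝒫 → (a b : Carrier 𝒫) →
    ((j : Carrier 𝒫) → IsJoin 𝒫 a b j → (c : Carrier 𝒫) → IsPC 𝒫 b j c →
    _⇒_ 𝒫 a b ≐ ｛ c ｝)
    × (_≤_ 𝒫 b a → (c : Carrier 𝒫) → IsPC 𝒫 b a c → _⇒_ 𝒫 a b ≐ ｛ c ｝)
lemma1 𝒫 _ a b =
  (λ j j-join c c-pc → ⇒-join 𝒫 j-join c-pc) ,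
  (λ b≤a c c-pc → ⇒-join 𝒫 (≤⇒IsJoin 𝒫 b≤a) c-pc)
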